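{- Let $n,m\ge 2$, let $p$ be a prime and $k\in\mathbb{N}$ such that $\varphi(p^{k+1})\mid n$, and suppose $m<p^{k+1}$. Then for every nonnegative integer $b$ and every $s\in\mathbb{N}$, $$P\Big(\sum_{i=1}^m x_i^n=b\,(p^s)^n\Big)=P\Big(\sum_{i=1}^m x_i^n=b\Big).$$
   Context: $P(f(x_1,\dots,x_m)=d)$ denotes the number of solutions $(x_1,\dots,x_m)$ in nonnegative integers. $\varphi$ is Euler's totient function. -}

module Defs where

open import Data.Nat using (ℕ; zero; suc; _+_; _*_; _^_)
open import Data.Nat.GCD using (gcd)
open import Data.Nat.Properties using (_≟_)
open import Data.List using (List; []; _∷_; length; filter; map; upTo; concatMap)
open import Relation.Nullary.Decidable using (⌊_⌋)

φ : ℕ → ℕ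
φ n = length (filter (λ k → gcd k n ≟ 1) (map suc (upTo n)))

tuples : ℕ → ℕ → List (List ℕ)
tuples zero    B = [] ∷ []
tuples (suc m) B = concatMap (λ x → map (x ∷_) (tuples m B)) (upTo (suc B))

powSum : ℕ → List ℕ → ℕ
powSum n []       = 0
powSum n (x ∷ xs) = x ^ n + powSum n xs

-- Any solution has xᵢ ≤ xᵢ^n ≤ d (n ≥ 1), so enumerating the box {0,…,d}^m
-- counts all solutions in nonnegative integers (for n ≥ 1).
P : (m n d : ℕ) → ℕ
P m n d = length (filter (λ xs → powSum n xs ≟ d) (tuples m d))

-- Write Q = p^(k+1). Since φ(Q) = p^k (p - 1) divides n, and n ≥ k + 1, Euler's theorem gives
-- x^n ≡ 1 (mod Q) when p ∤ x, while x^n ≡ 0 (mod Q) when p ∣ x. So Σ xᵢ^n ≡ #{i | p ∤ xᵢ} (mod Q),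
-- and as m < Q the sum is divisible by Q only if p divides every xᵢ. Hence xᵢ ↦ p xᵢ matches the
-- solutions of Σ xᵢ^n = c with those of Σ xᵢ^n = c p^n; iterate s times.
-- Euler's theorem for p^(k+1) comes from Fermat's little theorem (via the binomial theorem) by
-- lifting: a ≡ 1 (mod p^j) implies a^p ≡ 1 (mod p^(j+1)).
module Submission where

open import Defs
open import Data.Nat
  using (ℕ; zero; suc; _+_; _*_; _^_; _∸_; _≤_; _<_; _≤?_; z≤n; s≤s; z<s; s<s; NonZero; >-nonZero)
open import Data.Nat.Properties
open import Data.Nat.Divisibility
open import Data.Nat.Combinatorics using (_C_; nC1≡n; nCn≡1; k>n⇒nCk≡0; nCk+nC[k+1]≡[n+1]C[k+1])
open import Data.Nat.Coprimality using (Coprime; coprime⇒gcd≡1; gcd≡1⇒coprime; coprime-divisor)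
open import Data.Nat.GCD using (gcd; gcd-greatest; gcd[m,n]∣m; gcd[m,n]∣n)
open import Data.Nat.Primality
  using (Prime; euclidsLemma; prime⇒irreducible; prime⇒nonZero; ¬prime[0]; ¬prime[1])
open import Data.Nat.Tactic.RingSolver using (solve-∀)
open import Data.List using (List; []; _∷_; [_]; length; filter; map; upTo; applyUpTo; concatMap; _++_)
open import Data.List.Properties
  using (length-++; filter-++; filter-accept; filter-reject; filter-none; concatMap-pure; map-upTo)
open import Data.List.Relation.Unary.All using (universal)
open import Data.List.Relation.Unary.All.Properties using (map⁺)
open import Data.Product using (∃-syntax; _,_)
open import Data.Sum using (inj₁; inj₂)
open import Function using (id)
open import Relation.Nullary using (¬_; yes; no; contradiction)
open import Relation.Unary using (Pred; Decidable)
open import Relation.Binary.PropositionalEquality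
  using (_≡_; _≢_; refl; sym; trans; cong; cong₂; subst; subst₂; module ≡-Reasoning)
open ≡-Reasoning

∑< : ℕ → (ℕ → ℕ) → ℕ
∑< zero    f = 0
∑< (suc N) f = f 0 + ∑< N (λ i → f (suc i))

syntax ∑< N (λ i → f) = ∑[ i < N ] f

∑-cong : ∀ N {f g : ℕ → ℕ} → (∀ i → i < N → f i ≡ g i) → ∑< N f ≡ ∑< N g
∑-cong zero    f≡g = refl
∑-cong (suc N) f≡g = cong₂ _+_ (f≡g 0 z<s) (∑-cong N λ i i<N → f≡g (suc i) (s<s i<N))

∑-zero : ∀ N {f : ℕ → ℕ} → (∀ i → i < N → f i ≡ 0) → ∑< N f ≡ 0
∑-zero zero    f≡0 = refl
∑-zero (suc N) f≡0 = cong₂ _+_ (f≡0 0 z<s) (∑-zero N λ i i<N → f≡0 (suc i) (s<s i<N))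

∑-head-only : ∀ N .{{_ : NonZero N}} (f : ℕ → ℕ) → (∀ r → 0 < r → r < N → f r ≡ 0) → ∑< N f ≡ f 0
∑-head-only (suc N) f f≡0 =
  trans (cong (f 0 +_) (∑-zero N λ i i<N → f≡0 (suc i) z<s (s<s i<N))) (+-identityʳ (f 0))

∑-const : ∀ N c → ∑[ _ < N ] c ≡ N * c
∑-const zero    c = refl
∑-const (suc N) c = cong (c +_) (∑-const N c)

∑-last : ∀ N f → ∑< (suc N) f ≡ ∑< N f + f N
∑-last zero    f = +-comm (f 0) 0
∑-last (suc N) f = trans (cong (f 0 +_) (∑-last N λ i → f (suc i))) (sym (+-assoc (f 0) _ _))

∑-split : ∀ a b f → ∑< (a + b) f ≡ ∑< a f + ∑[ i < b ] f (a + i)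
∑-split zero    b f = refl
∑-split (suc a) b f = trans (cong (f 0 +_) (∑-split a b λ i → f (suc i))) (sym (+-assoc (f 0) _ _))

∑-blocks : ∀ N p f → ∑< (N * p) f ≡ ∑[ y < N ] ∑[ r < p ] f (y * p + r)
∑-blocks zero    p f = refl
∑-blocks (suc N) p f = begin
  ∑< (p + N * p) f
    ≡⟨ ∑-split p (N * p) f ⟩
  ∑< p f + ∑[ i < N * p ] f (p + i)
    ≡⟨ cong (∑< p f +_) (∑-blocks N p λ i → f (p + i)) ⟩
  ∑< p f + ∑[ y < N ] ∑[ r < p ] f (p + (y * p + r))
    ≡⟨ cong (∑< p f +_) (∑-cong N λ y _ → ∑-cong p λ r _ → cong f (sym (+-assoc p (y * p) r))) ⟩
  ∑< p f + ∑[ y < N ] ∑[ r < p ] f (suc y * p + r)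
    ∎

∑-distrib-+ : ∀ N f g → ∑[ i < N ] (f i + g i) ≡ ∑< N f + ∑< N g
∑-distrib-+ zero    f g = refl
∑-distrib-+ (suc N) f g =
  trans (cong (f 0 + g 0 +_) (∑-distrib-+ N (λ i → f (suc i)) (λ i → g (suc i)))) (swap (f 0) (g 0) _ _)
  where
  swap : ∀ a b c d → a + b + (c + d) ≡ a + c + (b + d)
  swap = solve-∀

*-distribˡ-∑ : ∀ x N f → x * ∑< N f ≡ ∑[ i < N ] (x * f i)
*-distribˡ-∑ x zero    f = *-zeroʳ x
*-distribˡ-∑ x (suc N) f =
  trans (*-distribˡ-+ x (f 0) _) (cong (x * f 0 +_) (*-distribˡ-∑ x N λ i → f (suc i)))

∣-∑ : ∀ {d} N f → (∀ i → i < N → d ∣ f i) → d ∣ ∑< N f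
∣-∑ zero    f d∣f = _ ∣0
∣-∑ (suc N) f d∣f = ∣m∣n⇒∣m+n (d∣f 0 z<s) (∣-∑ N _ λ i i<N → d∣f (suc i) (s<s i<N))

^-distribʳ-* : ∀ a b n → (a * b) ^ n ≡ a ^ n * b ^ n
^-distribʳ-* a b zero    = refl
^-distribʳ-* a b (suc n) = trans (cong (a * b *_) (^-distribʳ-* a b n)) (interchange a b (a ^ n) (b ^ n))
  where
  interchange : ∀ a b x y → a * b * (x * y) ≡ a * x * (b * y)
  interchange = solve-∀

m≤m^n : ∀ m n .{{_ : NonZero n}} → m ≤ m ^ n
m≤m^n zero    (suc n) = z≤n
m≤m^n (suc m) (suc n) = m≤m*n (suc m) (suc m ^ n) {{m^n≢0 (suc m) n}}

n<m^n : ∀ {m} → 1 < m → ∀ n → n < m ^ n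
n<m^n 1<m zero    = z<s
n<m^n {m} 1<m (suc n) =
  ≤-trans (s≤s (m≤n+m (suc n) n))
    (≤-trans (+-mono-≤ ih (≤-trans ih (≤-reflexive (sym (+-identityʳ _))))) (*-monoˡ-≤ (m ^ n) 1<m))
  where
  ih = n<m^n 1<m n

p∣x⇒p^e∣x^n : ∀ {p x e n} → p ∣ x → e ≤ n → p ^ e ∣ x ^ n
p∣x⇒p^e∣x^n {p} {e = e} {n} (divides a refl) e≤n =
  subst (p ^ e ∣_) (sym (^-distribʳ-* a p n)) (∣n⇒∣m*n (a ^ n) p^e∣p^n)
  where
  p^e∣p^n : p ^ e ∣ p ^ n
  p^e∣p^n = divides (p ^ (n ∸ e))
    (trans (cong (p ^_) (sym (m+[n∸m]≡n e≤n))) (trans (^-distribˡ-+-* p e (n ∸ e)) (*-comm (p ^ e) _)))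

∤-offset : ∀ {p} y {r} → 0 < r → r < p → ¬ p ∣ y * p + r
∤-offset y 0<r r<p p∣yp+r = <⇒≱ r<p (∣⇒≤ {{>-nonZero 0<r}} (∣m+n∣m⇒∣n p∣yp+r (n∣m*n y)))

∣-∸-residue : ∀ {Q d u a e} t → a ≤ d → a ≡ e + t * Q → Q ∣ d + u → Q ∣ (d ∸ a) + (e + u)
∣-∸-residue {Q} {d} {u} {e = e} t a≤d refl Q∣d+u = ∣m+n∣m⇒∣n (subst (Q ∣_) regroup Q∣d+u) (n∣m*n t)
  where
  regroup : d + u ≡ t * Q + ((d ∸ (e + t * Q)) + (e + u))
  regroup = trans (cong (_+ u) (sym (m∸n+n≡m a≤d))) (shuffle (d ∸ (e + t * Q)) e (t * Q) u)
    where
    shuffle : ∀ r e tQ u → r + (e + tQ) + u ≡ tQ + (r + (e + u))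
    shuffle = solve-∀

module _ {a p} {A : Set a} {P : Pred A p} (P? : Decidable P) where

  length-filter-concatMap : ∀ {b} {B : Set b} (h : B → List A) (f : ℕ → B) N →
    length (filter P? (concatMap h (applyUpTo f N))) ≡ ∑[ i < N ] length (filter P? (h (f i)))
  length-filter-concatMap h f zero    = refl
  length-filter-concatMap h f (suc N) = begin
    length (filter P? (h (f 0) ++ concatMap h (applyUpTo (λ i → f (suc i)) N)))
      ≡⟨ cong length (filter-++ P? (h (f 0)) _) ⟩
    length (filter P? (h (f 0)) ++ filter P? (concatMap h (applyUpTo (λ i → f (suc i)) N)))
      ≡⟨ length-++ (filter P? (h (f 0))) ⟩
    length (filter P? (h (f 0))) + length (filter P? (concatMap h (applyUpTo (λ i → f (suc i)) N)))
      ≡⟨ cong (length (filter P? (h (f 0))) +_) (length-filter-concatMap h (λ i → f (suc i)) N) ⟩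
    ∑[ i < suc N ] length (filter P? (h (f i)))
      ∎

module _ {a b p q} {A : Set a} {B : Set b} {P : Pred B p} {Q : Pred A q}
         (P? : Decidable P) (Q? : Decidable Q) (g : A → B) where

  length-filter-map : (∀ x → P (g x) → Q x) → (∀ x → Q x → P (g x)) → ∀ xs →
    length (filter P? (map g xs)) ≡ length (filter Q? xs)
  length-filter-map P⇒Q Q⇒P []       = refl
  length-filter-map P⇒Q Q⇒P (x ∷ xs) with P? (g x) | Q? x
  ... | yes _  | yes _  = cong suc (length-filter-map P⇒Q Q⇒P xs)
  ... | no  _  | no  _  = length-filter-map P⇒Q Q⇒P xs
  ... | yes Pgx | no ¬Qx = contradiction (P⇒Q x Pgx) ¬Qx
  ... | no ¬Pgx | yes Qx = contradiction (Q⇒P x Qx) ¬Pgx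

[1+k]*[1+n]C[1+k]≡[1+n]*nCk : ∀ n k → suc k * (suc n C suc k) ≡ suc n * (n C k)
[1+k]*[1+n]C[1+k]≡[1+n]*nCk zero    zero    = refl
[1+k]*[1+n]C[1+k]≡[1+n]*nCk zero    (suc k)
  rewrite k>n⇒nCk≡0 {1} {suc (suc k)} (s<s z<s) | k>n⇒nCk≡0 {0} {suc k} z<s = *-zeroʳ (suc (suc k))
[1+k]*[1+n]C[1+k]≡[1+n]*nCk (suc n) zero    =
  trans (*-identityˡ _) (trans (nC1≡n (suc (suc n))) (sym (*-identityʳ (suc (suc n)))))
[1+k]*[1+n]C[1+k]≡[1+n]*nCk (suc n) (suc k) = begin
  suc (suc k) * (suc (suc n) C suc (suc k))  ≡⟨ cong (suc (suc k) *_) (pascal (suc n) (suc k)) ⟨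
  suc (suc k) * (A + B)                       ≡⟨ expand (suc k) A B ⟩
  suc k * A + A + suc (suc k) * B             ≡⟨ cong₂ (λ u v → u + A + v) (ih k) (ih (suc k)) ⟩
  suc n * a + A + suc n * b                   ≡⟨ cong (λ z → suc n * a + z + suc n * b) (pascal n k) ⟨
  suc n * a + (a + b) + suc n * b             ≡⟨ collect (suc n) a b ⟩
  suc (suc n) * (a + b)                       ≡⟨ cong (suc (suc n) *_) (pascal n k) ⟩
  suc (suc n) * A                             ∎
  where
  pascal = nCk+nC[k+1]≡[n+1]C[k+1]
  ih = [1+k]*[1+n]C[1+k]≡[1+n]*nCk n
  A = suc n C suc k
  B = suc n C suc (suc k)
  a = n C k
  b = n C suc k
  expand : ∀ k A B → suc k * (A + B) ≡ k * A + A + suc k * B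
  expand = solve-∀
  collect : ∀ n a b → n * a + (a + b) + n * b ≡ suc n * (a + b)
  collect = solve-∀

binomial : ∀ x e → suc x ^ e ≡ ∑[ i < suc e ] ((e C i) * x ^ i)
binomial x zero    = refl
binomial x (suc e) = begin
  suc x * suc x ^ e
    ≡⟨ cong (suc x *_) (binomial x e) ⟩
  S + x * S
    ≡⟨ +-comm S (x * S) ⟩
  x * S + S
    ≡⟨ cong₂ _+_ (*-distribˡ-∑ x (suc e) (T e)) S-shift ⟩
  ∑[ i < suc e ] (x * T e i) + suc (∑[ i < suc e ] T e (suc i))
    ≡⟨ +-suc _ _ ⟩
  suc (∑[ i < suc e ] (x * T e i) + ∑[ i < suc e ] T e (suc i))
    ≡⟨ cong suc (∑-distrib-+ (suc e) (λ i → x * T e i) (λ i → T e (suc i))) ⟨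
  suc (∑[ i < suc e ] (x * T e i + T e (suc i)))
    ≡⟨ cong suc (∑-cong (suc e) λ i _ → pascal-term i) ⟩
  ∑[ i < suc (suc e) ] T (suc e) i
    ∎
  where
  T : ℕ → ℕ → ℕ
  T e i = (e C i) * x ^ i
  S = ∑[ i < suc e ] T e i
  S-shift : S ≡ suc (∑[ i < suc e ] T e (suc i))
  S-shift = cong suc (sym (begin
    ∑[ i < suc e ] T e (suc i)
      ≡⟨ ∑-last e (λ i → T e (suc i)) ⟩
    ∑[ i < e ] T e (suc i) + (e C suc e) * x ^ suc e
      ≡⟨ cong (λ c → ∑[ i < e ] T e (suc i) + c * x ^ suc e) (k>n⇒nCk≡0 (n<1+n e)) ⟩
    ∑[ i < e ] T e (suc i) + 0
      ≡⟨ +-identityʳ _ ⟩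
    ∑[ i < e ] T e (suc i)
      ∎))
  pascal-term : ∀ i → x * T e i + T e (suc i) ≡ T (suc e) (suc i)
  pascal-term i = begin
    x * ((e C i) * x ^ i) + (e C suc i) * x ^ suc i
      ≡⟨ cong (_+ T e (suc i)) (x*[c*y]≡c*[x*y] x (e C i) (x ^ i)) ⟩
    (e C i) * x ^ suc i + (e C suc i) * x ^ suc i
      ≡⟨ *-distribʳ-+ (x ^ suc i) (e C i) (e C suc i) ⟨
    (e C i + e C suc i) * x ^ suc i
      ≡⟨ cong (_* x ^ suc i) (nCk+nC[k+1]≡[n+1]C[k+1] e i) ⟩
    (suc e C suc i) * x ^ suc i
      ∎
    where
    x*[c*y]≡c*[x*y] : ∀ x c y → x * (c * y) ≡ c * (x * y)
    x*[c*y]≡c*[x*y] = solve-∀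

p∣pC[1+k] : ∀ {p} → Prime p → ∀ k → suc k < p → p ∣ p C suc k
p∣pC[1+k] {zero}   pr = contradiction pr ¬prime[0]
p∣pC[1+k] {suc p'} pr k 1+k<p
  with euclidsLemma (suc k) (suc p' C suc k) pr
         (divides (p' C k) (trans ([1+k]*[1+n]C[1+k]≡[1+n]*nCk p' k) (*-comm (suc p') (p' C k))))
... | inj₁ p∣1+k = contradiction (∣⇒≤ p∣1+k) (<⇒≱ 1+k<p)
... | inj₂ p∣C   = p∣C

fermat : ∀ {p} → Prime p → ∀ x → ∃[ t ] x ^ p ≡ x + t * p
fermat {zero}       pr = contradiction pr ¬prime[0]
fermat {suc p'}     pr zero    = 0 , refl
fermat {p@(suc p')} pr (suc x) with fermat pr x
... | t , x^p≡x+tp = t + s , (begin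
  suc x ^ p
    ≡⟨ binomial x p ⟩
  suc (∑[ i < p ] T (suc i))
    ≡⟨ cong suc (∑-last p' (λ i → T (suc i))) ⟩
  suc (∑[ i < p' ] T (suc i) + (p C p) * x ^ p)
    ≡⟨ cong₂ (λ u c → suc (u + c * x ^ p)) middle (nCn≡1 p) ⟩
  suc (s * p + 1 * x ^ p)
    ≡⟨ cong (λ z → suc (s * p + 1 * z)) x^p≡x+tp ⟩
  suc (s * p + 1 * (x + t * p))
    ≡⟨ regroup s t x p ⟩
  suc x + (t + s) * p
    ∎)
  where
  T : ℕ → ℕ
  T i = (p C i) * x ^ i
  p∣middle : p ∣ ∑[ i < p' ] T (suc i)
  p∣middle = ∣-∑ p' _ λ i i<p' → ∣m⇒∣m*n (x ^ suc i) (p∣pC[1+k] pr i (s<s i<p'))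
  s = quotient p∣middle
  middle = m∣n⇒n≡quotient*m p∣middle
  regroup : ∀ s t x p → suc (s * p + 1 * (x + t * p)) ≡ suc x + (t + s) * p
  regroup = solve-∀

infix 4 _≡1-mod_
_≡1-mod_ : ℕ → ℕ → Set
a ≡1-mod M = ∃[ t ] a ≡ suc (t * M)

≡1-mod-* : ∀ {M a b} → a ≡1-mod M → b ≡1-mod M → a * b ≡1-mod M
≡1-mod-* {M} (t , refl) (s , refl) = t + s + t * s * M , expand t s M
  where
  expand : ∀ t s M → suc (t * M) * suc (s * M) ≡ suc ((t + s + t * s * M) * M)
  expand = solve-∀

≡1-mod-^ : ∀ {M a} → a ≡1-mod M → ∀ e → a ^ e ≡1-mod M
≡1-mod-^ a≡1 zero    = 0 , refl
≡1-mod-^ a≡1 (suc e) = ≡1-mod-* a≡1 (≡1-mod-^ a≡1 e)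

≡1-mod-∣ : ∀ {M a e n} → a ^ e ≡1-mod M → e ∣ n → a ^ n ≡1-mod M
≡1-mod-∣ {a = a} {e} a^e≡1 (divides w refl) =
  subst (_≡1-mod _) (trans (^-*-assoc a e w) (cong (a ^_) (*-comm e w))) (≡1-mod-^ a^e≡1 w)

*-cancelˡ-≡1-mod : ∀ {p x y t} → Prime p → ¬ p ∣ x → x * y ≡ x + t * p → y ≡1-mod p
*-cancelˡ-≡1-mod {p} {x} {zero} pr p∤x x0≡x+tp =
  contradiction (subst (p ∣_) (sym x≡0) (p ∣0)) p∤x
  where
  x≡0 = m+n≡0⇒m≡0 x (sym (trans (sym (*-zeroʳ x)) x0≡x+tp))
*-cancelˡ-≡1-mod {p} {x} {suc y} {t} pr p∤x xy≡x+tp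
  with euclidsLemma x y pr (divides t (+-cancelˡ-≡ x _ _ (trans (sym (*-suc x y)) xy≡x+tp)))
... | inj₁ p∣x              = contradiction p∣x p∤x
... | inj₂ (divides s y≡sp) = s , cong suc y≡sp

fermat-unit : ∀ {p x} → Prime p → ¬ p ∣ x → x ^ (p ∸ 1) ≡1-mod p
fermat-unit {zero}   pr = contradiction pr ¬prime[0]
fermat-unit {suc p'} {x} pr p∤x with fermat pr x
... | t , x^p≡x+tp = *-cancelˡ-≡1-mod {t = t} pr p∤x x^p≡x+tp

[1+u]^e-mod-u² : ∀ u e → ∃[ h ] suc u ^ e ≡ suc (e * u + u * u * h)
[1+u]^e-mod-u² u zero    = 0 , cong suc (sym (*-zeroʳ (u * u)))
[1+u]^e-mod-u² u (suc e) with [1+u]^e-mod-u² u e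
... | h , eq = e + h + u * h , trans (cong (suc u *_) eq) (expand u e h)
  where
  expand : ∀ u e h → suc u * suc (e * u + u * u * h) ≡ suc (suc e * u + u * u * (e + h + u * h))
  expand = solve-∀

≡1-mod-lift : ∀ {p M a} → a ≡1-mod p * M → a ^ p ≡1-mod p * (p * M)
≡1-mod-lift {p} {M} (t , refl) with [1+u]^e-mod-u² (t * (p * M)) p
... | h , eq = t + t * t * M * h , trans eq (regroup t p M h)
  where
  regroup : ∀ t p M h → suc (p * (t * (p * M)) + t * (p * M) * (t * (p * M)) * h)
                          ≡ suc ((t + t * t * M * h) * (p * (p * M)))
  regroup = solve-∀

≡1-mod-^-p^ : ∀ {p b} → b ≡1-mod p → ∀ j → b ^ (p ^ j) ≡1-mod p ^ suc j
≡1-mod-^-p^ {p} {b} b≡1 zero    = subst₂ _≡1-mod_ (sym (*-identityʳ b)) (sym (*-identityʳ p)) b≡1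
≡1-mod-^-p^ {p} {b} b≡1 (suc j) =
  subst (_≡1-mod _) (trans (^-*-assoc b (p ^ j) p) (cong (b ^_) (*-comm (p ^ j) p)))
        (≡1-mod-lift {p} (≡1-mod-^-p^ b≡1 j))

coprime-^ : ∀ {p a} → Prime p → ¬ p ∣ a → ∀ j → Coprime a (p ^ j)
coprime-^ pr p∤a zero    (_ , d∣1) = ∣1⇒≡1 d∣1
coprime-^ {p} pr p∤a (suc j) {d} (d∣a , d∣p^[1+j]) with prime⇒irreducible pr (gcd[m,n]∣n d p)
... | inj₁ gcd≡1 = coprime-^ pr p∤a j (d∣a , coprime-divisor (gcd≡1⇒coprime gcd≡1) d∣p^[1+j])
... | inj₂ gcd≡p = contradiction (∣-trans (subst (_∣ d) gcd≡p (gcd[m,n]∣m d p)) d∣a) p∤a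

p∣a⇒gcd[a,p^[1+k]]≢1 : ∀ {p a} k → Prime p → p ∣ a → gcd a (p ^ suc k) ≢ 1
p∣a⇒gcd[a,p^[1+k]]≢1 {p} k pr p∣a gcd≡1 =
  ¬prime[1] (subst Prime (∣1⇒≡1 (subst (p ∣_) gcd≡1 (gcd-greatest p∣a (m∣m*n (p ^ k))))) pr)

φ-prime-power : ∀ {p} → Prime p → ∀ k → φ (p ^ suc k) ≡ p ^ k * (p ∸ 1)
φ-prime-power {zero}        pr = contradiction pr ¬prime[0]
φ-prime-power {p@(suc p')} pr k = begin
  length (filter U? (map suc (upTo Q)))
    ≡⟨ cong (λ xs → length (filter U? xs)) (trans (map-upTo suc Q) (sym (concatMap-pure _))) ⟩
  length (filter U? (concatMap [_] (applyUpTo suc Q)))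
    ≡⟨ length-filter-concatMap U? [_] suc Q ⟩
  ∑[ i < Q ] unit (suc i)
    ≡⟨ cong (λ N → ∑[ i < N ] unit (suc i)) (*-comm p (p ^ k)) ⟩
  ∑[ i < p ^ k * p ] unit (suc i)
    ≡⟨ ∑-blocks (p ^ k) p (λ i → unit (suc i)) ⟩
  ∑[ y < p ^ k ] ∑[ r < p ] unit (suc (y * p + r))
    ≡⟨ ∑-cong (p ^ k) (λ y _ → units-in-block y) ⟩
  ∑[ _ < p ^ k ] p'
    ≡⟨ ∑-const (p ^ k) p' ⟩
  p ^ k * p'
    ∎
  where
  Q = p ^ suc k
  U? = λ i → gcd i Q ≟ 1
  unit : ℕ → ℕ
  unit i = length (filter U? [ i ])
  units-in-block : ∀ y → ∑[ r < p ] unit (suc (y * p + r)) ≡ p'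
  units-in-block y = begin
    ∑[ r < p ] unit (suc (y * p + r))
      ≡⟨ ∑-last p' (λ r → unit (suc (y * p + r))) ⟩
    ∑[ r < p' ] unit (suc (y * p + r)) + unit (suc (y * p + p'))
      ≡⟨ cong₂ _+_ (∑-cong p' coprime-offset) multiple-last ⟩
    ∑[ _ < p' ] 1 + 0
      ≡⟨ trans (+-identityʳ _) (trans (∑-const p' 1) (*-identityʳ p')) ⟩
    p'
      ∎
    where
    coprime-offset : ∀ r → r < p' → unit (suc (y * p + r)) ≡ 1
    coprime-offset r r<p' =
      cong length (filter-accept U? {suc (y * p + r)} {[]} (coprime⇒gcd≡1 (coprime-^ pr p∤ (suc k))))
      where
      p∤ : ¬ p ∣ suc (y * p + r)
      p∤ = subst (λ z → ¬ p ∣ z) (+-suc (y * p) r) (∤-offset y z<s (s<s r<p'))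
    multiple-last : unit (suc (y * p + p')) ≡ 0
    multiple-last = cong length (filter-reject U? {suc (y * p + p')} {[]} (p∣a⇒gcd[a,p^[1+k]]≢1 k pr p∣))
      where
      p∣ : p ∣ suc (y * p + p')
      p∣ = divides (suc y) (trans (sym (+-suc (y * p) p')) (+-comm (y * p) p))

euler-prime-power : ∀ {p x} → Prime p → ¬ p ∣ x → ∀ k → x ^ φ (p ^ suc k) ≡1-mod p ^ suc k
euler-prime-power {p} {x} pr p∤x k =
  subst (_≡1-mod _) (trans (^-*-assoc x (p ∸ 1) (p ^ k))
                           (cong (x ^_) (trans (*-comm (p ∸ 1) (p ^ k)) (sym (φ-prime-power pr k)))))
        (≡1-mod-^-p^ (fermat-unit pr p∤x) k)

k<φ[p^[1+k]] : ∀ {p} → Prime p → ∀ k → k < φ (p ^ suc k)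
k<φ[p^[1+k]] {zero}             pr = contradiction pr ¬prime[0]
k<φ[p^[1+k]] {suc zero}         pr = contradiction pr ¬prime[1]
k<φ[p^[1+k]] {p@(suc (suc p'))} pr k =
  subst (k <_) (sym (φ-prime-power pr k)) (<-≤-trans (n<m^n (s<s z<s) k) (m≤m*n (p ^ k) (suc p')))

module PowerSumCount (n : ℕ) where

  completions : (ℕ → ℕ) → ℕ → ℕ → ℕ
  completions f d x with x ^ n ≤? d
  ... | yes _ = f (d ∸ x ^ n)
  ... | no  _ = 0

  completions-≤ : ∀ f {d x} → x ^ n ≤ d → completions f d x ≡ f (d ∸ x ^ n)
  completions-≤ f {d} {x} x^n≤d with x ^ n ≤? d
  ... | yes _     = refl
  ... | no x^n≰d = contradiction x^n≤d x^n≰d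

  completions-≰ : ∀ f {d x} → ¬ x ^ n ≤ d → completions f d x ≡ 0
  completions-≰ f {d} {x} x^n≰d with x ^ n ≤? d
  ... | yes x^n≤d = contradiction x^n≤d x^n≰d
  ... | no _      = refl

  completions-scale : ∀ {f g : ℕ → ℕ} {q} .{{_ : NonZero q}} → (∀ d → f (d * q) ≡ g d) →
    ∀ {c x y} → x ^ n ≡ y ^ n * q → completions f (c * q) x ≡ completions g c y
  completions-scale {f} {g} {q} f≡g {c} {x} {y} x^n≡y^nq with y ^ n ≤? c
  ... | yes y^n≤c = begin
    completions f (c * q) x   ≡⟨ completions-≤ f (subst (_≤ c * q) (sym x^n≡y^nq) (*-monoˡ-≤ q y^n≤c)) ⟩
    f (c * q ∸ x ^ n)         ≡⟨ cong (λ z → f (c * q ∸ z)) x^n≡y^nq ⟩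
    f (c * q ∸ y ^ n * q)     ≡⟨ cong f (*-distribʳ-∸ q c (y ^ n)) ⟨
    f ((c ∸ y ^ n) * q)       ≡⟨ f≡g (c ∸ y ^ n) ⟩
    g (c ∸ y ^ n)             ∎
  ... | no y^n≰c  =
    completions-≰ f λ le → y^n≰c (*-cancelʳ-≤ (y ^ n) c q (subst (_≤ c * q) x^n≡y^nq le))

  count : ℕ → ℕ → ℕ → ℕ
  count zero    N zero    = 1
  count zero    N (suc _) = 0
  count (suc m) N d       = ∑[ x < N ] completions (count m N) d x

  count₀-pos : ∀ N {d} → 0 < d → count 0 N d ≡ 0
  count₀-pos N {suc d} _ = refl

  length-filter-tuples : ∀ m B d →
    length (filter (λ xs → powSum n xs ≟ d) (tuples m B)) ≡ count m (suc B) d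
  length-filter-tuples zero    B zero    = refl
  length-filter-tuples zero    B (suc d) = refl
  length-filter-tuples (suc m) B d =
    trans (length-filter-concatMap Sol? (λ x → map (x ∷_) (tuples m B)) id (suc B))
          (∑-cong (suc B) λ x _ → solutions-with-head x)
    where
    Sol? = λ xs → powSum n xs ≟ d
    solutions-with-head : ∀ x →
      length (filter Sol? (map (x ∷_) (tuples m B))) ≡ completions (count m (suc B)) d x
    solutions-with-head x with x ^ n ≤? d
    ... | yes x^n≤d =
      trans (length-filter-map Sol? (λ xs → powSum n xs ≟ d ∸ x ^ n) (x ∷_)
               (λ xs sum≡d → trans (sym (m+n∸m≡n (x ^ n) (powSum n xs))) (cong (_∸ x ^ n) sum≡d))
               (λ xs sum≡d∸x^n → trans (cong (x ^ n +_) sum≡d∸x^n) (m+[n∸m]≡n x^n≤d))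
               (tuples m B))
            (length-filter-tuples m B (d ∸ x ^ n))
    ... | no x^n≰d = cong length (filter-none Sol? (map⁺ (universal no-solution (tuples m B))))
      where
      no-solution : ∀ xs → ¬ x ^ n + powSum n xs ≡ d
      no-solution xs sum≡d = x^n≰d (subst (x ^ n ≤_) sum≡d (m≤m+n (x ^ n) _))

  Bounds : ℕ → ℕ → Set
  Bounds N d = ∀ x → x ^ n ≤ d → x < N

  count-extend : ∀ m e {N d} → Bounds N d → count m N d ≡ count m (N + e) d
  count-extend zero    e {d = zero}  _     = refl
  count-extend zero    e {d = suc d} _     = refl
  count-extend (suc m) e {N} {d}     bound = begin
    ∑[ x < N ] completions (count m N) d x     ≡⟨ ∑-cong N (λ x _ → same-completions x) ⟩
    ∑< N g                                     ≡⟨ +-identityʳ _ ⟨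
    ∑< N g + 0                                 ≡⟨ cong (∑< N g +_) (∑-zero e λ i _ → beyond i) ⟨
    ∑< N g + ∑[ i < e ] g (N + i)              ≡⟨ ∑-split N e g ⟨
    ∑< (N + e) g                               ∎
    where
    g = completions (count m (N + e)) d
    same-completions : ∀ x → completions (count m N) d x ≡ g x
    same-completions x with x ^ n ≤? d
    ... | yes x^n≤d = count-extend m e (λ z le → bound z (≤-trans le (m∸n≤m d (x ^ n))))
    ... | no  _     = refl
    beyond : ∀ i → g (N + i) ≡ 0
    beyond i = completions-≰ _ λ le → <⇒≱ (bound (N + i) le) (m≤m+n N i)

  count-box : ∀ m {N N' d} → Bounds N d → Bounds N' d → count m N d ≡ count m N' d
  count-box m {N} {N'} {d} bN bN' = begin
    count m N d         ≡⟨ count-extend m N' bN ⟩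
    count m (N + N') d  ≡⟨ cong (λ M → count m M d) (+-comm N N') ⟩
    count m (N' + N) d  ≡⟨ count-extend m N bN' ⟨
    count m N' d        ∎

  bounds-suc : .{{_ : NonZero n}} → ∀ d → Bounds (suc d) d
  bounds-suc d x x^n≤d = s≤s (≤-trans (m≤m^n x n) x^n≤d)

  bounds-scaled : .{{_ : NonZero n}} → ∀ p .{{_ : NonZero p}} c → Bounds (suc c * p) (c * p ^ n)
  bounds-scaled p c x x^n≤cq = ≰⇒> λ b≤x → <⇒≱ (cq<x^n b≤x) x^n≤cq
    where
    cq<x^n : suc c * p ≤ x → c * p ^ n < x ^ n
    cq<x^n b≤x = <-≤-trans (m<n+m (c * p ^ n) (m^n>0 p n))
      (≤-trans (*-monoˡ-≤ (p ^ n) (m≤m^n (suc c) n))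
        (≤-trans (≤-reflexive (sym (^-distribʳ-* (suc c) p n))) (^-monoˡ-≤ n b≤x)))

module Scaling {n p Q : ℕ} .{{_ : NonZero p}}
  (p∣⇒Q∣^n : ∀ {x} → p ∣ x → Q ∣ x ^ n)
  (p∤⇒^n≡1 : ∀ {x} → ¬ p ∣ x → x ^ n ≡1-mod Q) where

  open PowerSumCount n

  -- Each xᵢ^n is ≡ 0 or 1 (mod Q), so a sum of m of them is ≡ j (mod Q) for some j ≤ m,
  -- never ≡ -u with 0 < u < Q - m.
  count-vanishes : ∀ m N d u → 0 < u → m + u < Q → Q ∣ d + u → count m N d ≡ 0
  count-vanishes zero    N zero    u 0<u u<Q Q∣u =
    contradiction (∣⇒≤ {{>-nonZero 0<u}} Q∣u) (<⇒≱ u<Q)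
  count-vanishes zero    N (suc d) _ _   _   _   = refl
  count-vanishes (suc m) N d       u 0<u m+u<Q Q∣d+u = ∑-zero N λ x _ → no-completion x
    where
    no-completion : ∀ x → completions (count m N) d x ≡ 0
    no-completion x with x ^ n ≤? d | p ∣? x
    ... | no _      | _ = refl
    ... | yes x^n≤d | yes p∣x with p∣⇒Q∣^n p∣x
    ...   | divides t x^n≡tQ =
      count-vanishes m N (d ∸ x ^ n) u 0<u (<-trans (n<1+n (m + u)) m+u<Q)
                     (∣-∸-residue t x^n≤d x^n≡tQ Q∣d+u)
    no-completion x | yes x^n≤d | no p∤x with p∤⇒^n≡1 p∤x
    ...   | t , x^n≡1+tQ =
      count-vanishes m N (d ∸ x ^ n) (suc u) z<s (subst (_< Q) (sym (+-suc m u)) m+u<Q)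
                     (∣-∸-residue t x^n≤d x^n≡1+tQ Q∣d+u)

  count-scale : ∀ m → m < Q → ∀ N c → count m (N * p) (c * p ^ n) ≡ count m N c
  count-scale zero    _     N zero    = refl
  count-scale zero    _     N (suc c) =
    count₀-pos (N * p) (<-≤-trans (m^n>0 p n) (m≤m+n (p ^ n) (c * p ^ n)))
  count-scale (suc m) 1+m<Q N c = begin
    ∑[ x < N * p ] completions (count m (N * p)) (c * p ^ n) x
      ≡⟨ ∑-blocks N p _ ⟩
    ∑[ y < N ] ∑[ r < p ] completions (count m (N * p)) (c * p ^ n) (y * p + r)
      ≡⟨ ∑-cong N (λ y _ → ∑-head-only p _ (off-multiple y)) ⟩
    ∑[ y < N ] completions (count m (N * p)) (c * p ^ n) (y * p + 0)
      ≡⟨ ∑-cong N (λ y _ → completions-scale {{m^n≢0 p n}} (count-scale m m<Q N)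
                             (trans (cong (_^ n) (+-identityʳ (y * p))) (^-distribʳ-* y p n))) ⟩
    ∑[ y < N ] completions (count m N) c y
      ∎
    where
    m<Q = <-trans (n<1+n m) 1+m<Q
    Q∣cq+0 : Q ∣ c * p ^ n + 0
    Q∣cq+0 = subst (Q ∣_) (sym (+-identityʳ _)) (∣n⇒∣m*n c (p∣⇒Q∣^n ∣-refl))
    off-multiple : ∀ y r → 0 < r → r < p → completions (count m (N * p)) (c * p ^ n) (y * p + r) ≡ 0
    off-multiple y r 0<r r<p with (y * p + r) ^ n ≤? c * p ^ n | p∤⇒^n≡1 (∤-offset y 0<r r<p)
    ... | no _  | _            = refl
    ... | yes x^n≤cq | t , x^n≡1+tQ =
      count-vanishes m (N * p) _ 1 z<s (subst (_< Q) (+-comm 1 m) 1+m<Q)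
                     (∣-∸-residue t x^n≤cq x^n≡1+tQ Q∣cq+0)

  P-scale : .{{_ : NonZero n}} → ∀ {m} → m < Q → ∀ c → P m n (c * p ^ n) ≡ P m n c
  P-scale {m} m<Q c = begin
    P m n (c * p ^ n)                      ≡⟨ length-filter-tuples m (c * p ^ n) (c * p ^ n) ⟩
    count m (suc (c * p ^ n)) (c * p ^ n)  ≡⟨ count-box m (bounds-suc (c * p ^ n)) (bounds-scaled p c) ⟩
    count m (suc c * p) (c * p ^ n)        ≡⟨ count-scale m m<Q (suc c) c ⟩
    count m (suc c) c                      ≡⟨ length-filter-tuples m c c ⟨
    P m n c                                ∎

  P-scale-^ : .{{_ : NonZero n}} → ∀ {m} → m < Q → ∀ b s → P m n (b * (p ^ s) ^ n) ≡ P m n b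
  P-scale-^ {m} m<Q b zero    = cong (P m n) (trans (cong (b *_) (^-zeroˡ n)) (*-identityʳ b))
  P-scale-^ {m} m<Q b (suc s) = begin
    P m n (b * (p * p ^ s) ^ n)        ≡⟨ cong (P m n) (trans (cong (b *_) (^-distribʳ-* p (p ^ s) n))
                                                              (regroup b (p ^ n) ((p ^ s) ^ n))) ⟩
    P m n (b * (p ^ s) ^ n * p ^ n)    ≡⟨ P-scale m<Q (b * (p ^ s) ^ n) ⟩
    P m n (b * (p ^ s) ^ n)            ≡⟨ P-scale-^ m<Q b s ⟩
    P m n b                            ∎
    where
    regroup : ∀ b x y → b * (x * y) ≡ b * y * x
    regroup = solve-∀

proposition2 : (n m p k : ℕ) → 2 ≤ n → 2 ≤ m → Prime p →
    φ (p ^ (k + 1)) ∣ n → m < p ^ (k + 1) →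
    (b s : ℕ) → P m n (b * (p ^ s) ^ n) ≡ P m n b
proposition2 n m p k 2≤n _ pr φ∣n m<Q with k + 1 | +-comm k 1
... | _ | refl = P-scale-^ m<Q
  where
  instance
    _ = prime⇒nonZero pr
    _ = >-nonZero (<-trans z<s 2≤n)
  open Scaling {n} {p} {p ^ suc k}
    (λ p∣x → p∣x⇒p^e∣x^n p∣x (≤-trans (k<φ[p^[1+k]] pr k) (∣⇒≤ φ∣n)))
    (λ p∤x → ≡1-mod-∣ (euler-prime-power pr p∤x k) φ∣n)
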